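{- For every constant $\epsilon>0$, the flow LP for Constrained Connectivity-Degree has an integrality gap of $\Omega(n^{\frac19-\epsilon})$; that is, there are instances with $n$ vertices (for arbitrarily large $n$) on which the minimum possible maximum degree of a safely connected subgraph is $\Omega(n^{\frac19-\epsilon})$ times the optimal value of the degree flow LP.
   Context: Constrained Connectivity: given a graph $G=(V,E)$, $n=|V|$, and for each ordered pair $(u,v)\in V\times V$ a set $S(u,v)\subseteq V$ with $u,v\in S(u,v)$. A subgraph $H$ of $G$ is safely connected if for every ordered pair $(u,v)$ there is a $u$–$v$ path in $H$ all of whose vertices lie in $S(u,v)$; Constrained Connectivity-Degree minimizes the maximum degree of $H$. Let $\mathcal{P}_{uv}$ be the set of $u$–$v$ paths in $G$ contained in $S(u,v)$. The degree flow LP: minimize $\lambda$ subject to $\sum_{P\in\mathcal{P}_{uv}}f(P)\ge1$ for all $(u,v)$; $\sum_{P\in\mathcal{P}_{uv}:e\in P}f(P)\le c_e$ for all $e\in E$ and all $(u,v)$; $\sum_{v:\{u,v\}\in E}c_{\{u,v\}}\le\lambda$ for all $u\in V$; $0\le c_e\le1$; $0\le f(P)\le1$. -}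

module Defs where

open import Data.Bool using (Bool; true; false; if_then_else_; _∧_; _∨_)
open import Data.Nat as ℕ using (ℕ; zero; suc)
open import Data.Fin as Fin using (Fin)
open import Data.Fin.Properties using (_≟_)
open import Data.List using (List; []; _∷_; map; foldr; allFin)
open import Data.Nat.ListAction using (sum)
open import Data.List.Relation.Unary.All using (All)
open import Data.List.Relation.Unary.Unique.Propositional using (Unique)
open import Data.Product using (_×_; proj₁; proj₂; ∃-syntax)
open import Data.Integer using (+_)
open import Data.Rational using (ℚ; 0ℚ; 1ℚ; _+_; _*_; _≤_; _/_)
open import Relation.Nullary.Decidable using (⌊_⌋)
open import Relation.Binary.PropositionalEquality using (_≡_)

toℚ : ℕ → ℚ
toℚ n = + n / 1

_^ℚ_ : ℚ → ℕ → ℚ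
q ^ℚ zero  = 1ℚ
q ^ℚ suc k = q * (q ^ℚ k)

sumℚ : List ℚ → ℚ
sumℚ = foldr _+_ 0ℚ

-- An instance of Constrained Connectivity: graph G and for every ordered
-- pair (u,v) a set S(u,v) ⊆ V (as a Boolean membership predicate) with u,v ∈ S(u,v).
record Instance : Set where
  field
    n      : ℕ
    G      : Fin n → Fin n → Bool
    G-sym  : ∀ x y → G x y ≡ G y x
    G-irr  : ∀ x → G x x ≡ false
    S      : Fin n → Fin n → Fin n → Bool
    S-src  : ∀ u v → S u v u ≡ true
    S-tgt  : ∀ u v → S u v v ≡ true

data IsWalk {n : ℕ} (A : Fin n → Fin n → Bool) : Fin n → Fin n → List (Fin n) → Set where
  single : ∀ {u} → IsWalk A u u (u ∷ [])
  step   : ∀ {u w v ps} → A u w ≡ true → IsWalk A w v ps → IsWalk A u v (u ∷ ps)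

SafePath : (I : Instance) → (Fin (Instance.n I) → Fin (Instance.n I) → Bool) →
           Fin (Instance.n I) → Fin (Instance.n I) → List (Fin (Instance.n I)) → Set
SafePath I A u v ps =
  IsWalk A u v ps × Unique ps × All (λ x → Instance.S I u v x ≡ true) ps

edgeIn : ∀ {n} → Fin n → Fin n → List (Fin n) → Bool
edgeIn x y []             = false
edgeIn x y (a ∷ [])       = false
edgeIn x y (a ∷ b ∷ rest) =
  ((⌊ a ≟ x ⌋ ∧ ⌊ b ≟ y ⌋) ∨ (⌊ a ≟ y ⌋ ∧ ⌊ b ≟ x ⌋)) ∨ edgeIn x y (b ∷ rest)

-- A feasible solution of the degree flow LP with objective value lam.
-- f u v lists the paths of P_uv with (possibly) nonzero flow, with their values f(P)
-- (paths not listed have f(P) = 0); the listed paths are pairwise distinct.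
-- c x y is the variable c_{x,y} (symmetric in x,y).
record FracSol (I : Instance) : Set where
  open Instance I
  field
    lam      : ℚ
    c        : Fin n → Fin n → ℚ
    f        : Fin n → Fin n → List (List (Fin n) × ℚ)
    c-sym    : ∀ x y → c x y ≡ c y x
    c-nonneg : ∀ x y → 0ℚ ≤ c x y
    c-le1    : ∀ x y → c x y ≤ 1ℚ
    f-paths  : ∀ u v → All (λ pw → SafePath I G u v (proj₁ pw)) (f u v)
    f-distinct : ∀ u v → Unique (map proj₁ (f u v))
    f-nonneg : ∀ u v → All (λ pw → 0ℚ ≤ proj₂ pw) (f u v)
    f-le1    : ∀ u v → All (λ pw → proj₂ pw ≤ 1ℚ) (f u v)
    demand   : ∀ u v → 1ℚ ≤ sumℚ (map proj₂ (f u v))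
    capacity : ∀ u v x y → G x y ≡ true →
               sumℚ (map (λ pw → if edgeIn x y (proj₁ pw) then proj₂ pw else 0ℚ) (f u v))
                 ≤ c x y
    degree   : ∀ u → sumℚ (map (λ v → if G u v then c u v else 0ℚ) (allFin n)) ≤ lam

IsSubgraph : (I : Instance) → (Fin (Instance.n I) → Fin (Instance.n I) → Bool) → Set
IsSubgraph I H = (∀ x y → H x y ≡ H y x) × (∀ x y → H x y ≡ true → Instance.G I x y ≡ true)

SafelyConnected : (I : Instance) → (Fin (Instance.n I) → Fin (Instance.n I) → Bool) → Set
SafelyConnected I H = ∀ u v → ∃[ ps ] SafePath I H u v ps

deg : ∀ {n} → (Fin n → Fin n → Bool) → Fin n → ℕ
deg {n} H u = sum (map (λ v → if H u v then 1 else 0) (allFin n))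

module Submission where

-- The instance is the complete tripartite graph K_{k,k,k} (parts X, Y, Z,
-- n = 3k vertices, k = m + 1), where two vertices of X may only be joined
-- through Y (S(u,v) = {u, v} ∪ Y), and every other pair is unconstrained.
--  * Fractionally, each pair u ≠ v sends 1/k along each of the k paths
--    u, w, v through the part avoiding u and v; with c ≡ 1/k every edge
--    meets the capacities and every vertex has LP degree 2 ≤ 3 = λ.
--  * Integrally, X and Y are independent, so a safe path between two
--    X-vertices is u, y, v with y ∈ Y: a fixed x₀ ∈ X shares a neighbour
--    with the m other X-vertices, and double counting the 2-walks from x₀
--    gives m ≤ Δ².  Hence n ≤ 2⁹Δ⁹, i.e. Δ ≥ ½ n^(1/9), and (½)^(9b) n^b ≤
--    Δ^(9b) n^(9a) for every ε = a/b; the gap is in fact Ω(√n).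

open import Defs
open import Data.Nat as ℕ using (ℕ; zero; suc; _≤_; z≤n; s≤s)
import Data.Nat
import Data.Nat.Properties as ℕP
open import Data.Nat.Tactic.RingSolver using (solve-∀)
open import Data.Nat.Coprimality using (1-coprimeTo)
import Data.Nat.Coprimality as Coprime
open import Data.Integer as ℤ using (+_)
import Data.Integer.Properties as ℤP
open import Data.Rational as ℚ using (ℚ; mkℚ; 0ℚ; 1ℚ; ½; _+_; _*_; _/_; _<_; *≤*)
  renaming (_≤_ to _≤ℚ_)
import Data.Rational.Properties as ℚP
open import Data.Fin as Fin using (Fin; _↑ˡ_)
open import Data.Fin.Properties as FinP using (_≟_)
open import Data.Fin.Patterns using (0F; 1F; 2F)
open import Data.Bool using (Bool; true; false; if_then_else_; not; _∧_; _∨_)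
import Data.Bool.Properties as BoolP
open import Data.Product using (_×_; _,_; proj₁; proj₂; ∃-syntax; Σ-syntax)
open import Data.Sum using (_⊎_; inj₁; inj₂)
open import Data.Empty using (⊥; ⊥-elim)
open import Data.List as List using (List; []; _∷_; map; allFin)
import Data.List.Properties as ListP
open import Data.List.Relation.Unary.All as All using (All; []; _∷_)
import Data.List.Relation.Unary.All.Properties as AllP
open import Data.List.Relation.Unary.AllPairs using ([]; _∷_)
open import Data.List.Relation.Unary.Unique.Propositional using (Unique)
import Data.List.Relation.Unary.Unique.Propositional.Properties as UniqueP
import Data.Vec.Functional as Vector
open import Algebra.Bundles using (CommutativeMonoid)
import Algebra.Properties.CommutativeSemigroup as CommSemigroupProperties
open import Function using (_∘_; id)
open import Relation.Nullary using (Dec; yes; no)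
open import Relation.Nullary.Decidable using (⌊_⌋)
open import Relation.Binary.PropositionalEquality

-- A list sum over a tabulation is the corresponding vector sum; this
-- translates the list-based sums of the definitions into sums over Fin.
foldr-tabulate : ∀ {A B : Set} (f : A → B → B) (e : B) {k} (g : Fin k → A) →
                 List.foldr f e (List.tabulate g) ≡ Vector.foldr f e g
foldr-tabulate f e {zero}  g = refl
foldr-tabulate f e {suc k} g = cong (f (g Fin.zero)) (foldr-tabulate f e (g ∘ Fin.suc))

foldr-map-tabulate : ∀ {A B C : Set} (f : B → C → C) (e : C) (g : A → B) {k} (h : Fin k → A) →
                     List.foldr f e (map g (List.tabulate h)) ≡ Vector.foldr f e (g ∘ h)
foldr-map-tabulate f e g h = trans (cong (List.foldr f e) (ListP.map-tabulate h g)) (foldr-tabulate f e (g ∘ h))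

module ΣN where
  open import Algebra.Properties.CommutativeMonoid.Sum ℕP.+-0-commutativeMonoid public
  open import Algebra.Properties.Semiring.Sum ℕP.+-*-semiring public using (*-distribˡ-sum; *-distribʳ-sum)

  sum-mono : ∀ {k} {g h : Fin k → ℕ} → (∀ i → g i ≤ h i) → sum g ≤ sum h
  sum-mono {zero}  _   = z≤n
  sum-mono {suc k} g≤h = ℕP.+-mono-≤ (g≤h Fin.zero) (sum-mono (g≤h ∘ Fin.suc))

  term≤sum : ∀ {k} (g : Fin k → ℕ) i → g i ≤ sum g
  term≤sum g Fin.zero    = ℕP.m≤m+n _ _
  term≤sum g (Fin.suc i) = ℕP.≤-trans (term≤sum (g ∘ Fin.suc) i) (ℕP.m≤n+m _ _)

  length≤sum : ∀ {k} (g : Fin k → ℕ) → (∀ i → 1 ≤ g i) → k ≤ sum g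
  length≤sum {zero}  g _   = z≤n
  length≤sum {suc k} g 1≤g = ℕP.+-mono-≤ (1≤g Fin.zero) (length≤sum (g ∘ Fin.suc) (1≤g ∘ Fin.suc))

  prefix≤sum : ∀ a {b} (g : Fin (a ℕ.+ b) → ℕ) → sum (λ i → g (i ↑ˡ b)) ≤ sum g
  prefix≤sum zero    g = z≤n
  prefix≤sum (suc a) g = ℕP.+-monoʳ-≤ (g Fin.zero) (prefix≤sum a (g ∘ Fin.suc))

-- toℚ is a monotone homomorphism of semirings ℕ → ℚ; all of this follows
-- from toℚ n being already in normal form n/1.
toℚ-normal : ∀ n → toℚ n ≡ mkℚ (+ n) 0 (Coprime.sym (1-coprimeTo n))
toℚ-normal n = ℚP.normalize-coprime (Coprime.sym (1-coprimeTo n))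

toℚ-suc : ∀ n → toℚ (suc n) ≡ 1ℚ + toℚ n
toℚ-suc n rewrite toℚ-normal n = sym (cong (_/ 1) numerator)
  where
  numerator : (+ 1 ℤ.* + 1) ℤ.+ (+ n ℤ.* + 1) ≡ + suc n
  numerator = cong (ℤ._+_ (+ 1)) (ℤP.*-identityʳ (+ n))

toℚ-* : ∀ a b → toℚ a * toℚ b ≡ toℚ (a ℕ.* b)
toℚ-* a b rewrite toℚ-normal a | toℚ-normal b = cong (_/ 1) (ℤP.+◃n≡+n (a ℕ.* b))

toℚ-mono : ∀ {a b} → a ≤ b → toℚ a ≤ℚ toℚ b
toℚ-mono {a} {b} a≤b rewrite toℚ-normal a | toℚ-normal b =
  *≤* (subst₂ ℤ._≤_ (sym (ℤP.*-identityʳ (+ a))) (sym (ℤP.*-identityʳ (+ b))) (ℤ.+≤+ a≤b))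

toℚ-^ : ∀ x e → toℚ x ^ℚ e ≡ toℚ (x ℕ.^ e)
toℚ-^ x zero    = refl
toℚ-^ x (suc e) = trans (cong (toℚ x *_) (toℚ-^ x e)) (toℚ-* x (x ℕ.^ e))

-- the unit fraction 1/(m+1), the LP capacity of every edge
unitFraction : ℕ → ℚ
unitFraction m = mkℚ (+ 1) m (1-coprimeTo (suc m))

unitFraction-inverse : ∀ m → toℚ (suc m) * unitFraction m ≡ 1ℚ
unitFraction-inverse m rewrite toℚ-normal (suc m) = ℚP.*-inverseʳ (mkℚ (+ suc m) 0 (Coprime.sym (1-coprimeTo (suc m))))

0≤unitFraction : ∀ m → 0ℚ ≤ℚ unitFraction m
0≤unitFraction m = *≤* (ℤ.+≤+ z≤n)

unitFraction≤1 : ∀ m → unitFraction m ≤ℚ 1ℚ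
unitFraction≤1 m = *≤* (ℤ.+≤+ (s≤s z≤n))

½^-nonNeg : ∀ e → ℚ.NonNegative (½ ^ℚ e)
½^-nonNeg zero    = _
½^-nonNeg (suc e) = ℚP.nonNeg*nonNeg⇒nonNeg ½ (½ ^ℚ e) {{½^-nonNeg e}}

½^*2^ : ∀ e → ½ ^ℚ e * toℚ (2 ℕ.^ e) ≡ 1ℚ
½^*2^ zero    = refl
½^*2^ (suc e) = begin
  (½ * ½ ^ℚ e) * toℚ (2 ℕ.* 2 ℕ.^ e)        ≡⟨ cong ((½ * ½ ^ℚ e) *_) (sym (toℚ-* 2 (2 ℕ.^ e))) ⟩
  (½ * ½ ^ℚ e) * (toℚ 2 * toℚ (2 ℕ.^ e))    ≡⟨ ℚ*.interchange ½ (½ ^ℚ e) (toℚ 2) (toℚ (2 ℕ.^ e)) ⟩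
  (½ * toℚ 2) * (½ ^ℚ e * toℚ (2 ℕ.^ e))    ≡⟨ cong ((½ * toℚ 2) *_) (½^*2^ e) ⟩
  1ℚ                                        ∎
  where
  open ≡-Reasoning
  module ℚ* = CommSemigroupProperties (CommutativeMonoid.commutativeSemigroup ℚP.*-1-commutativeMonoid)

halve-bound : ∀ e {x y} → x ≤ 2 ℕ.^ e ℕ.* y → ½ ^ℚ e * toℚ x ≤ℚ toℚ y
halve-bound e {x} {y} x≤2^ey = begin
  ½ ^ℚ e * toℚ x                          ≤⟨ ℚP.*-monoˡ-≤-nonNeg (½ ^ℚ e) {{½^-nonNeg e}} (toℚ-mono x≤2^ey) ⟩
  ½ ^ℚ e * toℚ (2 ℕ.^ e ℕ.* y)            ≡⟨ cong (½ ^ℚ e *_) (sym (toℚ-* (2 ℕ.^ e) y)) ⟩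
  ½ ^ℚ e * (toℚ (2 ℕ.^ e) * toℚ y)        ≡⟨ sym (ℚP.*-assoc (½ ^ℚ e) _ _) ⟩
  (½ ^ℚ e * toℚ (2 ℕ.^ e)) * toℚ y        ≡⟨ cong (_* toℚ y) (½^*2^ e) ⟩
  1ℚ * toℚ y                              ≡⟨ ℚP.*-identityˡ (toℚ y) ⟩
  toℚ y                                   ∎
  where open ℚP.≤-Reasoning

module ΣQ where
  open import Algebra.Properties.CommutativeMonoid.Sum ℚP.+-0-commutativeMonoid public

  sum-mono : ∀ {k} {g h : Fin k → ℚ} → (∀ i → g i ≤ℚ h i) → sum g ≤ℚ sum h
  sum-mono {zero}  _   = ℚP.≤-refl
  sum-mono {suc k} g≤h = ℚP.+-mono-≤ (g≤h Fin.zero) (sum-mono (g≤h ∘ Fin.suc))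

  sum-const : ∀ k q → sum {k} (λ _ → q) ≡ toℚ k * q
  sum-const zero    q = sym (ℚP.*-zeroˡ q)
  sum-const (suc k) q = begin
    q + sum {k} (λ _ → q)  ≡⟨ cong (_+_ q) (sum-const k q) ⟩
    q + toℚ k * q          ≡⟨ cong (_+ toℚ k * q) (sym (ℚP.*-identityˡ q)) ⟩
    1ℚ * q + toℚ k * q     ≡⟨ sym (ℚP.*-distribʳ-+ q 1ℚ (toℚ k)) ⟩
    (1ℚ + toℚ k) * q       ≡⟨ cong (_* q) (sym (toℚ-suc k)) ⟩
    toℚ (suc k) * q        ∎
    where open ≡-Reasoning

  sum-bound : ∀ {k} (g : Fin k → ℚ) {q} → (∀ i → g i ≤ℚ q) → sum g ≤ℚ toℚ k * q
  sum-bound {k} g {q} g≤q = ℚP.≤-trans (sum-mono g≤q) (ℚP.≤-reflexive (sum-const k q))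

  sum-atMostOne : ∀ {k} (P : Fin k → Bool) {q} → 0ℚ ≤ℚ q →
                  (∀ i j → P i ≡ true → P j ≡ true → i ≡ j) →
                  sum (λ i → if P i then q else 0ℚ) ≤ℚ q
  sum-atMostOne {zero}  P 0≤q _      = 0≤q
  sum-atMostOne {suc k} P {q} 0≤q unique with P Fin.zero in P0
  ... | true  = ℚP.≤-reflexive (trans (cong (_+_ q) (trans (sum-cong-≗ rest≡0) (sum-replicate-zero k)))
                                      (ℚP.+-identityʳ q))
    where
    rest≡0 : ∀ i → (if P (Fin.suc i) then q else 0ℚ) ≡ 0ℚ
    rest≡0 i with P (Fin.suc i) in Pi
    ... | true  with () ← unique (Fin.suc i) Fin.zero Pi P0
    ... | false = refl
  ... | false = ℚP.≤-trans (ℚP.≤-reflexive (ℚP.+-identityˡ _))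
                  (sum-atMostOne (P ∘ Fin.suc) 0≤q
                    (λ i j Pi Pj → FinP.suc-injective (unique _ _ Pi Pj)))

-- A simple u–v walk whose vertices lie in {u, v} ∪ Y, for an independent
-- set Y and distinct non-adjacent u, v, has exactly one interior vertex:
-- its second vertex is in Y, so its third cannot be in Y and must be v.
commonNeighbour : ∀ {n} (A : Fin n → Fin n → Bool) (Y : Fin n → Bool) →
  (∀ x → A x x ≢ true) → (∀ x y → Y x ≡ true → Y y ≡ true → A x y ≢ true) →
  ∀ {u v ps} → u ≢ v → A u v ≢ true →
  IsWalk A u v ps → Unique ps → All (λ x → x ≡ u ⊎ x ≡ v ⊎ Y x ≡ true) ps →
  ∃[ w ] (A u w ≡ true × A w v ≡ true)
commonNeighbour A Y loopless independent u≢v u≁v single _ _ = ⊥-elim (u≢v refl)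
commonNeighbour A Y loopless independent u≢v u≁v (step u~v single) _ _ = ⊥-elim (u≁v u~v)
commonNeighbour A Y loopless independent u≢v u≁v (step {w = w} u~w (step w~v single)) _ _ =
  w , u~w , w~v
commonNeighbour A Y loopless independent {u} {v} u≢v u≁v
  (step {w = w} u~w (step {w = w′} w~w′ (step _ _))) ((_ ∷ u≢w′ ∷ _) ∷ _) (_ ∷ w∈ ∷ w′∈ ∷ _)
  with w∈
... | inj₁ refl        = ⊥-elim (loopless u u~w)
... | inj₂ (inj₁ refl) = ⊥-elim (u≁v u~w)
... | inj₂ (inj₂ Yw) with w′∈
...   | inj₁ refl         = ⊥-elim (u≢w′ refl)
...   | inj₂ (inj₁ refl)  = w , u~w , w~w′
...   | inj₂ (inj₂ Yw′)   = ⊥-elim (independent w w′ Yw Yw′ w~w′)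

indicator : Bool → ℕ
indicator b = if b then 1 else 0

count : ∀ {n} → (Fin n → Bool) → ℕ
count P = ΣN.sum (indicator ∘ P)

deg≡count : ∀ {n} (A : Fin n → Fin n → Bool) u → deg A u ≡ count (A u)
deg≡count A u = foldr-map-tabulate ℕ._+_ 0 (indicator ∘ A u) id

-- In a graph of maximum degree Δ, at most Δ² vertices share a neighbour
-- with a fixed vertex x (double counting of the 2-walks starting at x).
secondNeighbourhood : ∀ {n} (A : Fin n → Fin n → Bool) Δ → (∀ u → deg A u ≤ Δ) →
  ∀ x (P : Fin n → Bool) → (∀ v → P v ≡ true → ∃[ w ] (A x w ≡ true × A w v ≡ true)) →
  count P ≤ Δ ℕ.* Δ
secondNeighbourhood {n} A Δ deg≤Δ x P reached = begin
  count P
    ≤⟨ ΣN.sum-mono P≤walks ⟩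
  ΣN.sum (λ v → ΣN.sum (λ w → walk w v))
    ≡⟨ ΣN.∑-comm (λ v w → walk w v) ⟩
  ΣN.sum (λ w → ΣN.sum (λ v → walk w v))
    ≡⟨ ΣN.sum-cong-≗ (λ w → sym (ΣN.*-distribˡ-sum (indicator (A x w)) (indicator ∘ A w))) ⟩
  ΣN.sum (λ w → indicator (A x w) ℕ.* count (A w))
    ≤⟨ ΣN.sum-mono (λ w → ℕP.*-monoʳ-≤ (indicator (A x w)) (degree w)) ⟩
  ΣN.sum (λ w → indicator (A x w) ℕ.* Δ)
    ≡⟨ sym (ΣN.*-distribʳ-sum Δ (indicator ∘ A x)) ⟩
  count (A x) ℕ.* Δ
    ≤⟨ ℕP.*-monoˡ-≤ Δ (degree x) ⟩
  Δ ℕ.* Δ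
    ∎
  where
  open ℕP.≤-Reasoning
  walk : Fin n → Fin n → ℕ
  walk w v = indicator (A x w) ℕ.* indicator (A w v)
  degree : ∀ u → count (A u) ≤ Δ
  degree u = subst (_≤ Δ) (deg≡count A u) (deg≤Δ u)
  P≤walks : ∀ v → indicator (P v) ≤ ΣN.sum (λ w → walk w v)
  P≤walks v with P v in Pv
  ... | false = z≤n
  ... | true with reached v Pv
  ...   | w , x~w , w~v = subst (_≤ ΣN.sum (λ w → walk w v))
                                (cong₂ (λ a b → indicator a ℕ.* indicator b) x~w w~v)
                                (ΣN.term≤sum (λ w → walk w v) w)

⌊≟⌋-refl : ∀ {n} (x : Fin n) → ⌊ x ≟ x ⌋ ≡ true
⌊≟⌋-refl x with x ≟ x
... | yes _   = refl
... | no x≢x = ⊥-elim (x≢x refl)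

witness : ∀ {A : Set} (a? : Dec A) → ⌊ a? ⌋ ≡ true → A
witness (yes a) _ = a

middle∈edge : ∀ {n} (a b c x y : Fin n) → edgeIn x y (a ∷ b ∷ c ∷ []) ≡ true → x ≡ b ⊎ y ≡ b
middle∈edge a b c x y onPath with b ≟ x | b ≟ y
... | yes b≡x | _       = inj₁ (sym b≡x)
... | no _    | yes b≡y = inj₂ (sym b≡y)
... | no _    | no _ with () ← trans (sym onPath)
      (cong₂ (λ s t → (s ∨ t) ∨ false) (BoolP.∧-zeroʳ ⌊ a ≟ x ⌋) (BoolP.∧-zeroʳ ⌊ a ≟ y ⌋))

module Tripartite (m : ℕ) where

  k n : ℕ
  k = suc m
  n = 3 ℕ.* k

  vertex : Fin 3 → Fin k → Fin n
  vertex = Fin.combine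

  part : Fin n → Fin 3
  part = Fin.quotient k

  part-vertex : ∀ p i → part (vertex p i) ≡ p
  part-vertex p i = cong proj₁ (FinP.remQuot-combine p i)

  vertex-injective : ∀ {p i j} → vertex p i ≡ vertex p j → i ≡ j
  vertex-injective {p} {i} {j} = FinP.combine-injectiveʳ p i p j

  X Y : Fin 3
  X = 0F
  Y = 1F

  -- a part different from two given ones (for p = q = X it is Y)
  avoid : (p q : Fin 3) → Σ[ r ∈ Fin 3 ] (p ≢ r × r ≢ q)
  avoid 0F 0F = 1F , (λ ()) , (λ ())
  avoid 0F 1F = 2F , (λ ()) , (λ ())
  avoid 0F 2F = 1F , (λ ()) , (λ ())
  avoid 1F 0F = 2F , (λ ()) , (λ ())
  avoid 1F 1F = 0F , (λ ()) , (λ ())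
  avoid 1F 2F = 0F , (λ ()) , (λ ())
  avoid 2F 0F = 1F , (λ ()) , (λ ())
  avoid 2F 1F = 0F , (λ ()) , (λ ())
  avoid 2F 2F = 0F , (λ ()) , (λ ())

  G : Fin n → Fin n → Bool
  G u v = not ⌊ part u ≟ part v ⌋

  adjacent : ∀ {u v} → part u ≢ part v → G u v ≡ true
  adjacent {u} {v} u≁v with part u ≟ part v
  ... | yes same = ⊥-elim (u≁v same)
  ... | no _     = refl

  nonadjacent : ∀ {u v} → part u ≡ part v → G u v ≢ true
  nonadjacent {u} {v} same with part u ≟ part v
  ... | yes _ = λ ()
  ... | no u≁v = ⊥-elim (u≁v same)

  G-sym : ∀ u v → G u v ≡ G v u
  G-sym u v with part u ≟ part v | part v ≟ part u
  ... | yes _    | yes _    = refl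
  ... | no _     | no _     = refl
  ... | yes same | no u≁v   = ⊥-elim (u≁v (sym same))
  ... | no u≁v   | yes same = ⊥-elim (u≁v (sym same))

  G-irr : ∀ u → G u u ≡ false
  G-irr u with part u ≟ part u
  ... | yes _  = refl
  ... | no u≁u = ⊥-elim (u≁u refl)

  inX inY : Fin n → Bool
  inX u = ⌊ part u ≟ X ⌋
  inY u = ⌊ part u ≟ Y ⌋

  S : Fin n → Fin n → Fin n → Bool
  S u v x = if inX u ∧ inX v then ⌊ x ≟ u ⌋ ∨ ⌊ x ≟ v ⌋ ∨ inY x else true

  S-src : ∀ u v → S u v u ≡ true
  S-src u v with inX u ∧ inX v
  ... | false = refl
  ... | true  = cong (_∨ ⌊ u ≟ v ⌋ ∨ inY u) (⌊≟⌋-refl u)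

  S-tgt : ∀ u v → S u v v ≡ true
  S-tgt u v with inX u ∧ inX v
  ... | false = refl
  ... | true  = trans (cong (λ b → ⌊ v ≟ u ⌋ ∨ b ∨ inY v) (⌊≟⌋-refl v))
                      (BoolP.∨-zeroʳ ⌊ v ≟ u ⌋)

  S-member : ∀ {u v x} → inX u ≡ true → inX v ≡ true → S u v x ≡ true →
             x ≡ u ⊎ x ≡ v ⊎ inY x ≡ true
  S-member {u} {v} {x} Xu Xv x∈S rewrite Xu | Xv with x ≟ u | x ≟ v
  ... | yes x≡u | _       = inj₁ x≡u
  ... | no _    | yes x≡v = inj₂ (inj₁ x≡v)
  ... | no _    | no _    = inj₂ (inj₂ x∈S)

  inst : Instance
  inst = record { n = n ; G = G ; G-sym = G-sym ; G-irr = G-irr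
                ; S = S ; S-src = S-src ; S-tgt = S-tgt }

  -- The fractional solution: c = 1/k on every edge; for u ≠ v the k paths
  -- u, w, v through the vertices w of a part avoiding those of u and v,
  -- each carrying flow 1/k.  A vertex has fewer than n = 3k edges, so λ = 3
  -- is feasible.

  q : ℚ
  q = unitFraction m

  c : Fin n → Fin n → ℚ
  c x y = if G x y then q else 0ℚ

  adjacent⇒≢ : ∀ {u v} → G u v ≡ true → u ≢ v
  adjacent⇒≢ {u} u~v refl with () ← trans (sym (G-irr u)) u~v

  middle : Fin n → Fin n → Fin k → Fin n
  middle u v = vertex (proj₁ (avoid (part u) (part v)))

  middle-injective : ∀ u v {t t′} → middle u v t ≡ middle u v t′ → t ≡ t′
  middle-injective u v = vertex-injective {proj₁ (avoid (part u) (part v))}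

  part-middle : ∀ u v t → part (middle u v t) ≡ proj₁ (avoid (part u) (part v))
  part-middle u v = part-vertex (proj₁ (avoid (part u) (part v)))

  u~middle : ∀ u v t → G u (middle u v t) ≡ true
  u~middle u v t = adjacent {u} {middle u v t}
    (λ same → proj₁ (proj₂ (avoid (part u) (part v))) (trans same (part-middle u v t)))

  middle~v : ∀ u v t → G (middle u v t) v ≡ true
  middle~v u v t = adjacent {middle u v t} {v}
    (λ same → proj₂ (proj₂ (avoid (part u) (part v))) (trans (sym (part-middle u v t)) same))

  S-middle : ∀ u v t → S u v (middle u v t) ≡ true
  S-middle u v t with inX u in Xu | inX v in Xv
  ... | false | _     = refl
  ... | true  | false = refl
  ... | true  | true  = trans (cong (λ b → ⌊ w ≟ u ⌋ ∨ ⌊ w ≟ v ⌋ ∨ b) Yw)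
                              (trans (cong (⌊ w ≟ u ⌋ ∨_) (BoolP.∨-zeroʳ _)) (BoolP.∨-zeroʳ _))
    where
    w : Fin n
    w = middle u v t
    Yw : inY w ≡ true
    Yw rewrite part-middle u v t | witness (part u ≟ X) Xu | witness (part v ≟ X) Xv = refl

  via : Fin n → Fin n → Fin k → List (Fin n)
  via u v t = u ∷ middle u v t ∷ v ∷ []

  via-safe : ∀ {u v} → u ≢ v → ∀ t → SafePath inst G u v (via u v t)
  via-safe {u} {v} u≢v t =
      step (u~middle u v t) (step (middle~v u v t) single)
    , (adjacent⇒≢ (u~middle u v t) ∷ u≢v ∷ []) ∷ (adjacent⇒≢ (middle~v u v t) ∷ []) ∷ [] ∷ []
    , S-src u v ∷ S-middle u v t ∷ S-tgt u v ∷ []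

  via-injective : ∀ u v {t t′} → via u v t ≡ via u v t′ → t ≡ t′
  via-injective u v same = middle-injective u v (ListP.∷-injectiveˡ (ListP.∷-injectiveʳ same))

  flow : (u v : Fin n) → Dec (u ≡ v) → List (List (Fin n) × ℚ)
  flow u v (yes _) = (u ∷ [] , 1ℚ) ∷ []
  flow u v (no _)  = List.tabulate (λ t → via u v t , q)

  flow-paths : ∀ u v d → All (λ pw → SafePath inst G u v (proj₁ pw)) (flow u v d)
  flow-paths u .u (yes refl) = (single , [] ∷ [] , S-src u u ∷ []) ∷ []
  flow-paths u v  (no u≢v)   = AllP.tabulate⁺ {f = λ t → via u v t , q} (via-safe u≢v)

  flow-distinct : ∀ u v d → Unique (map proj₁ (flow u v d))
  flow-distinct u v (yes _) = [] ∷ []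
  flow-distinct u v (no _)  = subst Unique (sym (ListP.map-tabulate (λ t → via u v t , q) proj₁))
    (UniqueP.tabulate⁺ {f = via u v} (via-injective u v))

  flow-nonneg : ∀ u v d → All (λ pw → 0ℚ ≤ℚ proj₂ pw) (flow u v d)
  flow-nonneg u v (yes _) = *≤* (ℤ.+≤+ z≤n) ∷ []
  flow-nonneg u v (no _)  = AllP.tabulate⁺ {f = λ t → via u v t , q} (λ _ → 0≤unitFraction m)

  flow-le1 : ∀ u v d → All (λ pw → proj₂ pw ≤ℚ 1ℚ) (flow u v d)
  flow-le1 u v (yes _) = ℚP.≤-refl ∷ []
  flow-le1 u v (no _)  = AllP.tabulate⁺ {f = λ t → via u v t , q} (λ _ → unitFraction≤1 m)

  flow-demand : ∀ u v d → 1ℚ ≤ℚ sumℚ (map proj₂ (flow u v d))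
  flow-demand u v (yes _) = ℚP.≤-reflexive (sym (ℚP.+-identityʳ 1ℚ))
  flow-demand u v (no u≢v) = ℚP.≤-reflexive (sym (begin
    sumℚ (map proj₂ (flow u v (no u≢v)))  ≡⟨ foldr-map-tabulate _+_ 0ℚ proj₂ (λ t → via u v t , q) ⟩
    ΣQ.sum {k} (λ _ → q)                  ≡⟨ ΣQ.sum-const k q ⟩
    toℚ k * q                             ≡⟨ unitFraction-inverse m ⟩
    1ℚ                                    ∎))
    where open ≡-Reasoning

  -- an edge lies on at most one of the paths via u v t
  flow-capacity : ∀ u v x y → G x y ≡ true → ∀ d →
    sumℚ (map (λ pw → if edgeIn x y (proj₁ pw) then proj₂ pw else 0ℚ) (flow u v d)) ≤ℚ c x y
  flow-capacity u v x y x~y d rewrite x~y = capacity d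
    where
    -- x and y lie in different parts, while all middle vertices share one
    notBothMiddle : ∀ {t t′} → x ≡ middle u v t → y ≡ middle u v t′ → ⊥
    notBothMiddle {t} {t′} x≡w y≡w′ = nonadjacent {x} {y}
      (trans (trans (cong part x≡w) (part-middle u v t)) (sym (trans (cong part y≡w′) (part-middle u v t′)))) x~y
    onOnePath : ∀ t t′ → edgeIn x y (via u v t) ≡ true → edgeIn x y (via u v t′) ≡ true → t ≡ t′
    onOnePath t t′ on on′ with middle∈edge u (middle u v t) v x y on | middle∈edge u (middle u v t′) v x y on′
    ... | inj₁ x≡w | inj₁ x≡w′ = middle-injective u v (trans (sym x≡w) x≡w′)
    ... | inj₂ y≡w | inj₂ y≡w′ = middle-injective u v (trans (sym y≡w) y≡w′)
    ... | inj₁ x≡w | inj₂ y≡w′ = ⊥-elim (notBothMiddle x≡w y≡w′)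
    ... | inj₂ y≡w | inj₁ x≡w′ = ⊥-elim (notBothMiddle x≡w′ y≡w)
    load : List (Fin n) × ℚ → ℚ
    load pw = if edgeIn x y (proj₁ pw) then proj₂ pw else 0ℚ
    capacity : ∀ d → sumℚ (map load (flow u v d)) ≤ℚ q
    capacity (yes _) = ℚP.≤-trans (ℚP.≤-reflexive (ℚP.+-identityʳ 0ℚ)) (0≤unitFraction m)
    capacity (no _)  = ℚP.≤-trans
      (ℚP.≤-reflexive (foldr-map-tabulate _+_ 0ℚ load (λ t → via u v t , q)))
      (ΣQ.sum-atMostOne (λ t → edgeIn x y (via u v t)) (0≤unitFraction m) onOnePath)

  -- every vertex has at most n incident edges, each of capacity 1/k, and n/k = 3
  degree : ∀ u → sumℚ (map (λ v → if G u v then c u v else 0ℚ) (allFin n)) ≤ℚ toℚ 3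
  degree u = begin
    sumℚ (map (λ v → if G u v then c u v else 0ℚ) (allFin n))
      ≡⟨ foldr-map-tabulate _+_ 0ℚ (λ v → if G u v then c u v else 0ℚ) id ⟩
    ΣQ.sum (λ v → if G u v then c u v else 0ℚ)  ≤⟨ ΣQ.sum-bound _ (λ v → incident≤q (G u v)) ⟩
    toℚ (3 ℕ.* k) * q                            ≡⟨ cong (_* q) (sym (toℚ-* 3 k)) ⟩
    (toℚ 3 * toℚ k) * q                          ≡⟨ ℚP.*-assoc (toℚ 3) (toℚ k) q ⟩
    toℚ 3 * (toℚ k * q)                          ≡⟨ cong (toℚ 3 *_) (unitFraction-inverse m) ⟩
    toℚ 3 * 1ℚ                                   ≡⟨ ℚP.*-identityʳ (toℚ 3) ⟩
    toℚ 3                                        ∎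
    where
    open ℚP.≤-Reasoning
    incident≤q : ∀ b → (if b then (if b then q else 0ℚ) else 0ℚ) ≤ℚ q
    incident≤q true  = ℚP.≤-refl
    incident≤q false = 0≤unitFraction m

  σ : FracSol inst
  σ = record
    { lam        = toℚ 3
    ; c          = c
    ; f          = λ u v → flow u v (u ≟ v)
    ; c-sym      = λ x y → cong (λ b → if b then q else 0ℚ) (G-sym x y)
    ; c-nonneg   = λ x y → c-nonneg (G x y)
    ; c-le1      = λ x y → c-le1 (G x y)
    ; f-paths    = λ u v → flow-paths u v (u ≟ v)
    ; f-distinct = λ u v → flow-distinct u v (u ≟ v)
    ; f-nonneg   = λ u v → flow-nonneg u v (u ≟ v)
    ; f-le1      = λ u v → flow-le1 u v (u ≟ v)
    ; demand     = λ u v → flow-demand u v (u ≟ v)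
    ; capacity   = λ u v x y x~y → flow-capacity u v x y x~y (u ≟ v)
    ; degree     = degree
    }
    where
    c-nonneg : ∀ b → 0ℚ ≤ℚ (if b then q else 0ℚ)
    c-nonneg true  = 0≤unitFraction m
    c-nonneg false = ℚP.≤-refl
    c-le1 : ∀ b → (if b then q else 0ℚ) ≤ℚ 1ℚ
    c-le1 true  = unitFraction≤1 m
    c-le1 false = *≤* (ℤ.+≤+ z≤n)

  x₀ : Fin n
  x₀ = vertex X 0F

  otherX : Fin n → Bool
  otherX v = inX v ∧ not ⌊ v ≟ x₀ ⌋

  otherX-spec : ∀ {v} → otherX v ≡ true → inX v ≡ true × v ≢ x₀
  otherX-spec {v} v∈ with inX v | v ≟ x₀
  ... | true | no v≢x₀ = refl , v≢x₀
  otherX-spec {v} () | true  | yes _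
  otherX-spec {v} () | false | _

  otherX-vertex : ∀ j → otherX (vertex X (Fin.suc j)) ≡ true
  otherX-vertex j with part (vertex X (Fin.suc j)) ≟ X | vertex X (Fin.suc j) ≟ x₀
  ... | yes _    | no _     = refl
  ... | no notX  | _        = ⊥-elim (notX (part-vertex X (Fin.suc j)))
  ... | yes _    | yes same with () ← vertex-injective {X} same

  m≤count-otherX : m ≤ count otherX
  m≤count-otherX = begin
    m
      ≤⟨ ΣN.length≤sum _ (λ j → ℕP.≤-reflexive (cong indicator (sym (otherX-vertex j)))) ⟩
    ΣN.sum (λ j → indicator (otherX (vertex X (Fin.suc j))))
      ≤⟨ ℕP.m≤n+m _ _ ⟩
    ΣN.sum (λ i → indicator (otherX (vertex X i)))
      ≤⟨ ΣN.prefix≤sum k (indicator ∘ otherX) ⟩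
    count otherX
      ∎
    where open ℕP.≤-Reasoning

  lowerBound : ∀ H → IsSubgraph inst H → SafelyConnected inst H →
               ∀ Δ → (∀ u → deg H u ≤ Δ) → m ≤ Δ ℕ.* Δ
  lowerBound H (_ , H⊆G) connected Δ deg≤Δ =
    ℕP.≤-trans m≤count-otherX (secondNeighbourhood H Δ deg≤Δ x₀ otherX reached)
    where
    sameSide : ∀ {x y} → part x ≡ part y → H x y ≢ true
    sameSide {x} {y} same = nonadjacent {x} {y} same ∘ H⊆G x y
    Y-independent : ∀ x y → inY x ≡ true → inY y ≡ true → H x y ≢ true
    Y-independent x y Yx Yy = sameSide (trans (witness (part x ≟ Y) Yx) (sym (witness (part y ≟ Y) Yy)))
    reached : ∀ v → otherX v ≡ true → ∃[ w ] (H x₀ w ≡ true × H w v ≡ true)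
    reached v v∈ with otherX-spec v∈ | connected x₀ v
    ... | Xv , v≢x₀ | ps , walk , unique , inS =
      commonNeighbour H inY (λ x → sameSide refl) Y-independent (v≢x₀ ∘ sym)
        (sameSide (trans (part-vertex X 0F) (sym (witness (part v ≟ X) Xv))))
        walk unique (All.map (S-member refl Xv) inS)

^-distribʳ-* : ∀ x y e → (x ℕ.* y) ℕ.^ e ≡ x ℕ.^ e ℕ.* y ℕ.^ e
^-distribʳ-* x y zero    = refl
^-distribʳ-* x y (suc e) = trans (cong ((x ℕ.* y) ℕ.*_) (^-distribʳ-* x y e))
                                 (ℕ*.interchange x y (x ℕ.^ e) (y ℕ.^ e))
  where module ℕ* = CommSemigroupProperties ℕP.*-commutativeSemigroup

vertexBound : ∀ m Δ → 1 ≤ m → m ≤ Δ ℕ.* Δ → 3 ℕ.* suc m ≤ 2 ℕ.^ 9 ℕ.* Δ ℕ.^ 9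
vertexBound m zero    1≤m m≤0 with () ← ℕP.≤-trans 1≤m m≤0
vertexBound m Δ@(suc _) 1≤m m≤Δ² = begin
  3 ℕ.* suc m                   ≤⟨ ℕP.*-monoʳ-≤ 3 (ℕP.+-monoˡ-≤ m 1≤m) ⟩
  3 ℕ.* (m ℕ.+ m)               ≤⟨ ℕP.*-monoʳ-≤ 3 (ℕP.+-mono-≤ m≤Δ² m≤Δ²) ⟩
  3 ℕ.* (Δ ℕ.* Δ ℕ.+ Δ ℕ.* Δ)   ≡⟨ double (Δ ℕ.* Δ) ⟩
  6 ℕ.* (Δ ℕ.* Δ)               ≤⟨ ℕP.*-mono-≤ {6} {2 ℕ.^ 9} (ℕP.m≤m+n 6 506) Δ²≤Δ⁹ ⟩
  2 ℕ.^ 9 ℕ.* Δ ℕ.^ 9           ∎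
  where
  open ℕP.≤-Reasoning
  double : ∀ x → 3 ℕ.* (x ℕ.+ x) ≡ 6 ℕ.* x
  double = solve-∀
  Δ²≤Δ⁹ : Δ ℕ.* Δ ≤ Δ ℕ.^ 9
  Δ²≤Δ⁹ = subst (_≤ Δ ℕ.^ 9) (cong (Δ ℕ.*_) (ℕP.*-identityʳ Δ)) (ℕP.^-monoʳ-≤ Δ {2} {9} (s≤s (s≤s z≤n)))

powerBound : ∀ a b {n Δ} → n ≤ 2 ℕ.^ 9 ℕ.* Δ ℕ.^ 9 → 1 ≤ n →
             n ℕ.^ b ≤ 2 ℕ.^ (9 ℕ.* b) ℕ.* (Δ ℕ.^ (9 ℕ.* b) ℕ.* n ℕ.^ (9 ℕ.* a))
powerBound a b {n} {Δ} n≤ 1≤n = begin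
  n ℕ.^ b
    ≤⟨ ℕP.^-monoˡ-≤ b n≤ ⟩
  (2 ℕ.^ 9 ℕ.* Δ ℕ.^ 9) ℕ.^ b
    ≡⟨ ^-distribʳ-* (2 ℕ.^ 9) (Δ ℕ.^ 9) b ⟩
  (2 ℕ.^ 9) ℕ.^ b ℕ.* (Δ ℕ.^ 9) ℕ.^ b
    ≡⟨ cong₂ ℕ._*_ (ℕP.^-*-assoc 2 9 b) (ℕP.^-*-assoc Δ 9 b) ⟩
  2 ℕ.^ (9 ℕ.* b) ℕ.* Δ ℕ.^ (9 ℕ.* b)
    ≤⟨ ℕP.*-monoʳ-≤ (2 ℕ.^ (9 ℕ.* b)) (ℕP.m≤m*n (Δ ℕ.^ (9 ℕ.* b)) (n ℕ.^ (9 ℕ.* a)) {{n^≢0}}) ⟩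
  2 ℕ.^ (9 ℕ.* b) ℕ.* (Δ ℕ.^ (9 ℕ.* b) ℕ.* n ℕ.^ (9 ℕ.* a))
    ∎
  where
  open ℕP.≤-Reasoning
  n^≢0 : ℕ.NonZero (n ℕ.^ (9 ℕ.* a))
  n^≢0 = ℕP.m^n≢0 n (9 ℕ.* a) {{ℕ.>-nonZero 1≤n}}

rationalBound : ∀ a b {n Δ} → n ≤ 2 ℕ.^ 9 ℕ.* Δ ℕ.^ 9 → 1 ≤ n →
  (½ ^ℚ (9 ℕ.* b)) * (toℚ n ^ℚ b) ≤ℚ (toℚ Δ ^ℚ (9 ℕ.* b)) * (toℚ n ^ℚ (9 ℕ.* a))
rationalBound a b {n} {Δ} n≤ 1≤n = begin
  ½ ^ℚ (9 ℕ.* b) * toℚ n ^ℚ b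
    ≡⟨ cong (½ ^ℚ (9 ℕ.* b) *_) (toℚ-^ n b) ⟩
  ½ ^ℚ (9 ℕ.* b) * toℚ (n ℕ.^ b)
    ≤⟨ halve-bound (9 ℕ.* b) (powerBound a b n≤ 1≤n) ⟩
  toℚ (Δ ℕ.^ (9 ℕ.* b) ℕ.* n ℕ.^ (9 ℕ.* a))
    ≡⟨ sym (toℚ-* (Δ ℕ.^ (9 ℕ.* b)) (n ℕ.^ (9 ℕ.* a))) ⟩
  toℚ (Δ ℕ.^ (9 ℕ.* b)) * toℚ (n ℕ.^ (9 ℕ.* a))
    ≡⟨ sym (cong₂ _*_ (toℚ-^ Δ (9 ℕ.* b)) (toℚ-^ n (9 ℕ.* a))) ⟩
  toℚ Δ ^ℚ (9 ℕ.* b) * toℚ n ^ℚ (9 ℕ.* a)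
    ∎
  where open ℚP.≤-Reasoning

-- The theorem: in the instance Tripartite (N + 1) on n = 3(N + 2) vertices
-- the LP value is at most 3 while every safely connected subgraph has
-- maximum degree Δ with n ≤ 2⁹Δ⁹; with C = 1/6 this is the claimed bound.

theorem22 : (a b : ℕ) → 1 ≤ a → 1 ≤ b →
    ∃[ C ] (0ℚ < C) × (∀ (N : ℕ) → ∃[ I ] (N ≤ Instance.n I) × ∃[ σ ]
      (∀ (H : Fin (Instance.n I) → Fin (Instance.n I) → Bool) →
        IsSubgraph I H → SafelyConnected I H →
        ∀ (Δ : ℕ) → (∀ u → deg H u ≤ Δ) →
        ((C * FracSol.lam {I} σ) ^ℚ (9 Data.Nat.* b)) * (toℚ (Instance.n I) ^ℚ b)
          ≤ℚ (toℚ Δ ^ℚ (9 Data.Nat.* b)) * (toℚ (Instance.n I) ^ℚ (9 Data.Nat.* a))))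
theorem22 a b _ _ = + 1 / 6 , ℚ.*<* (ℤ.+<+ (s≤s z≤n)) , λ N →
  let open Tripartite (suc N) in
  inst , ℕP.≤-trans (ℕP.m≤n+m N 2) (ℕP.m≤m+n (suc (suc N)) _) , σ ,
  λ H subgraph connected Δ deg≤Δ →
    let m≤Δ²   = lowerBound H subgraph connected Δ deg≤Δ
        n≤2⁹Δ⁹ = vertexBound (suc N) Δ (s≤s z≤n) m≤Δ²
    -- C · λ = 1/6 · 3 = ½ holds by computation
    in rationalBound a b {n} {Δ} n≤2⁹Δ⁹ (s≤s z≤n)
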